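{- Let $q$ be a prime power, $m,r\ge 1$ integers, and let $V_{m,r}=\{f\in\mathbb{F}_q[x_1,\ldots,x_m]:\deg(f)\le r\}$. For every set of points $\mathcal{P}\subseteq\mathbb{F}_q^{m+1}$ and every set of polynomials $\mathcal{L}\subseteq V_{m,r}$, $$\left|I(\mathcal{P},\mathcal{L})-\frac{|\mathcal{P}||\mathcal{L}|}{q}\right|\le q^{(\dim V_{m,r}-1)/2}\sqrt{|\mathcal{P}||\mathcal{L}|},$$ where $\dim V_{m,r}=\binom{m+r}{r}$ is the dimension of $V_{m,r}$ as an $\mathbb{F}_q$-vector space.
   Context: A point $v=(v_1,\ldots,v_{m+1})\in\mathbb{F}_q^{m+1}$ is incident to a polynomial $f\in\mathbb{F}_q[x_1,\ldots,x_m]$ if $f(v_1,\ldots,v_m)=v_{m+1}$. For $\mathcal{P}\subseteq\mathbb{F}_q^{m+1}$ and a set of polynomials $\mathcal{L}$, $I(\mathcal{P},\mathcal{L})=|\{(v,f)\in\mathcal{P}\times\mathcal{L}: f(v_1,\ldots,v_m)=v_{m+1}\}|$. -}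

module Defs where

open import Level using (Level; _⊔_)
open import Data.Nat as ℕ using (ℕ; zero; suc; _∸_)
open import Data.List as List using (List; []; _∷_; length; upTo; concatMap)
open import Data.List.Relation.Unary.Any using (Any)
open import Data.Nat.ListAction using (sum)
open import Data.Vec as Vec using (Vec; []; _∷_)
open import Data.Product using (∃; _×_)
open import Relation.Nullary using (¬_; yes; no)
open import Relation.Binary using (Decidable)
open import Algebra.Bundles using (CommutativeRing)
import Data.List.Relation.Unary.Unique.Setoid as USetoid
import Data.Vec.Relation.Binary.Equality.Setoid as VecEq

-- Its order q is the length of that
-- enumeration (necessarily a prime power).
record FiniteField (c ℓ : Level) : Set (Level.suc (c ⊔ ℓ)) where
  field
    commRing : CommutativeRing c ℓ
  open CommutativeRing commRing public
  field
    _≟_       : Decidable _≈_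
    0≉1       : ¬ (0# ≈ 1#)
    inverse   : ∀ x → ¬ (x ≈ 0#) → ∃ λ y → x * y ≈ 1#
    elements  : List Carrier
    complete  : ∀ x → Any (x ≈_) elements
    distinct  : USetoid.Unique setoid elements

  order : ℕ
  order = length elements

-- Exponent vectors (e₁,…,e_m) with e₁+…+e_m ≤ r, each listed exactly once.
-- These index the monomials x₁^e₁⋯x_m^e_m spanning V_{m,r}.
monomials : (m r : ℕ) → List (Vec ℕ m)
monomials zero    r = [] ∷ []
monomials (suc m) r =
  concatMap (λ e → List.map (e ∷_) (monomials m (r ∸ e))) (upTo (suc r))

module _ {c ℓ : Level} (F : FiniteField c ℓ) where
  open FiniteField F

  pow : Carrier → ℕ → Carrier
  pow x zero    = 1#
  pow x (suc n) = x * pow x n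

  monoVal : ∀ {m} → Vec ℕ m → Vec Carrier m → Carrier
  monoVal []       []       = 1#
  monoVal (e ∷ es) (x ∷ xs) = pow x e * monoVal es xs

  -- An element of V_{m,r}: its coefficient vector w.r.t. the monomial basis.
  Poly : (m r : ℕ) → Set c
  Poly m r = Vec Carrier (length (monomials m r))

  private
    evalAux : ∀ {m} (ms : List (Vec ℕ m)) → Vec Carrier (length ms) → Vec Carrier m → Carrier
    evalAux []       []       x = 0#
    evalAux (e ∷ es) (a ∷ as) x = a * monoVal e x + evalAux es as x

  eval : ∀ {m r} → Poly m r → Vec Carrier m → Carrier
  eval {m} {r} f x = evalAux (monomials m r) f x

  UniquePoints : ∀ {m} → List (Vec Carrier (suc m)) → Set (c ⊔ ℓ)
  UniquePoints {m} = USetoid.Unique (VecEq.≋-setoid setoid (suc m))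

  UniquePolys : ∀ {m r} → List (Poly m r) → Set (c ⊔ ℓ)
  UniquePolys {m} {r} = USetoid.Unique (VecEq.≋-setoid setoid (length (monomials m r)))

  incident : ∀ {m r} → Vec Carrier (suc m) → Poly m r → ℕ
  incident v f with eval f (Vec.init v) ≟ Vec.last v
  ... | yes _ = 1
  ... | no  _ = 0

  incidences : ∀ {m r} → List (Vec Carrier (suc m)) → List (Poly m r) → ℕ
  incidences P L = sum (List.map (λ v → sum (List.map (incident v) L)) P)

-- Identify a polynomial of degree ≤ r with its coefficient vector f = (f₀ , g) ∈ 𝔽^n,
-- n = dim V_{m,r}, f₀ the constant coefficient. The point (x , y) is incident to f iff f
-- lies on the affine hyperplane H_(x,y) : f₀ + g · U(x) = y, where U(x) lists the values of
-- the nonconstant monomials at x; since r ≥ 1 the coordinates x_i are among them, so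
-- distinct points give distinct hyperplanes. With D(f) = Σ_{v ∈ P} (q·[f ∈ H_v] − 1) we
-- have q·I − |P||L| = Σ_{f ∈ L} D(f), and Cauchy–Schwarz gives
--   (q·I − |P||L|)² ≤ |L| Σ_{f ∈ 𝔽^n} D(f)² = |L| Σ_{v,w ∈ P} K(v,w),
--   K(v,w) = Σ_f (q·[f ∈ H_v] − 1)(q·[f ∈ H_w] − 1) = q (q |H_v ∩ H_w| − q^(n-1)).
-- A hyperplane has q^(n-1) points, two nonparallel ones meet in q^(n-2) and distinct parallel
-- ones are disjoint, so K(v,v) ≤ q^(n+1) and K(v,w) ≤ 0 for v ≠ w: the sum is at most
-- |P| q^(n+1), which is the claimed bound multiplied by q².

module Submission where

-- A separate module, so that its ℤ arithmetic does not clash with the ℕ operators of the statement.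
module IncidenceBound where

  open import Level using (Level; _⊔_)
  open import Function using (_∘_; _⇔_; mk⇔)
  open import Function.Construct.Composition using (_⇔-∘_)
  open import Data.Bool using (if_then_else_)
  open import Data.Empty using (⊥-elim)
  open import Data.Product using (∃; _×_; _,_)
  open import Data.Product.Relation.Binary.Pointwise.NonDependent using (×-setoid)
  open import Data.Sum using (inj₁; inj₂)
  open import Data.Nat as ℕ using (ℕ; zero; suc)
  import Data.Nat.Properties as ℕ
  open import Data.Nat.Combinatorics using (_C_; nCn≡1; nCk+nC[k+1]≡[n+1]C[k+1])
  open import Data.Nat.ListAction using (sum)
  open import Data.Integer as ℤ using (ℤ; +_; 0ℤ; 1ℤ; _+_; _*_; -_; _-_; _≤_)
  import Data.Integer.Properties as ℤ
  open import Data.Integer.Tactic.RingSolver using (solve-∀)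
  open import Data.List as List using (List; []; _∷_; _++_; length; concatMap)
  import Data.List.Properties as Listₚ
  open import Data.List.Relation.Unary.All as All using (All; []; _∷_)
  import Data.List.Relation.Unary.All.Properties as Allₚ
  open import Data.List.Relation.Unary.AllPairs using ([]; _∷_)
  open import Data.List.Relation.Unary.Any as Any using (Any; here; there; _─_)
  import Data.List.Relation.Unary.Any.Properties as Anyₚ
  import Data.List.Relation.Unary.Unique.Setoid as UniqueSetoid
  import Data.List.Relation.Unary.Unique.Setoid.Properties as Uniqueₚ
  import Data.List.Membership.Setoid as MembershipSetoid
  import Data.List.Membership.Setoid.Properties as Membershipₚ
  open import Data.Vec as Vec using (Vec; []; _∷_)
  open import Data.Vec.Relation.Binary.Pointwise.Inductive as Pointwise using ([]; _∷_)
  import Data.Vec.Relation.Binary.Equality.Setoid as VecEquality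
  import Data.Vec.Relation.Unary.Any as VecAny
  open import Relation.Binary using (Setoid; Decidable; _Preserves_⟶_)
  open import Relation.Binary.PropositionalEquality
    using (_≡_; _≗_; refl; sym; trans; cong; cong₂; subst; module ≡-Reasoning)
  import Relation.Binary.Reasoning.Setoid as ≈-Reasoning
  open import Relation.Nullary using (¬_; Dec; yes; no; does)
  open import Relation.Nullary.Decidable using (does-⇔)
  open import Defs

  private
    variable
      a b : Level
      A : Set a
      B : Set b

  ∑ : List A → (A → ℤ) → ℤ
  ∑ []       f = 0ℤ
  ∑ (x ∷ xs) f = f x + ∑ xs f

  -- ∑ binds more loosely than _+_ and _*_: ∑[ x ∈ xs ] f x * g x sums the products.
  infix 5 ∑
  syntax ∑ xs (λ x → e) = ∑[ x ∈ xs ] e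

  infixl 9 _²
  _² : ℤ → ℤ
  i ² = i * i

  ∑-cong : ∀ (xs : List A) {f g : A → ℤ} → f ≗ g → ∑ xs f ≡ ∑ xs g
  ∑-cong []       f≗g = refl
  ∑-cong (x ∷ xs) f≗g = cong₂ _+_ (f≗g x) (∑-cong xs f≗g)

  ∑-distrib-+ : ∀ (xs : List A) (f g : A → ℤ) → ∑[ x ∈ xs ] (f x + g x) ≡ ∑ xs f + ∑ xs g
  ∑-distrib-+ []       f g = refl
  ∑-distrib-+ (x ∷ xs) f g =
    trans (cong (_+_ (f x + g x)) (∑-distrib-+ xs f g)) (interchange (f x) (g x) _ _)
    where
    interchange : ∀ a b c d → a + b + (c + d) ≡ a + c + (b + d)
    interchange = solve-∀

  ∑-*ˡ : ∀ (xs : List A) (c : ℤ) (f : A → ℤ) → ∑[ x ∈ xs ] (c * f x) ≡ c * ∑ xs f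
  ∑-*ˡ []       c f = sym (ℤ.*-zeroʳ c)
  ∑-*ˡ (x ∷ xs) c f = trans (cong (_+_ (c * f x)) (∑-*ˡ xs c f)) (sym (ℤ.*-distribˡ-+ c (f x) _))

  ∑-neg : ∀ (xs : List A) (f : A → ℤ) → ∑[ x ∈ xs ] (- f x) ≡ - ∑ xs f
  ∑-neg []       f = refl
  ∑-neg (x ∷ xs) f = trans (cong (_+_ (- f x)) (∑-neg xs f)) (sym (ℤ.neg-distrib-+ (f x) _))

  ∑-*ʳ : ∀ (xs : List A) (c : ℤ) (f : A → ℤ) → ∑[ x ∈ xs ] (f x * c) ≡ ∑ xs f * c
  ∑-*ʳ xs c f =
    trans (∑-cong xs (λ x → ℤ.*-comm (f x) c)) (trans (∑-*ˡ xs c f) (ℤ.*-comm c (∑ xs f)))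

  ∑-linear : ∀ (xs : List A) (c : ℤ) (f g : A → ℤ) → ∑[ x ∈ xs ] (c * f x - g x) ≡ c * ∑ xs f - ∑ xs g
  ∑-linear xs c f g = trans (∑-distrib-+ xs _ _) (cong₂ _+_ (∑-*ˡ xs c f) (∑-neg xs g))

  ∑-square : ∀ (xs : List A) (f : A → ℤ) → (∑ xs f) ² ≡ ∑[ x ∈ xs ] ∑[ y ∈ xs ] f x * f y
  ∑-square xs f = sym (trans (∑-cong xs (λ x → ∑-*ˡ xs (f x) f)) (∑-*ʳ xs (∑ xs f) f))

  ∑-const : ∀ (xs : List A) (c : ℤ) → ∑[ x ∈ xs ] c ≡ + length xs * c
  ∑-const []       c = refl
  ∑-const (x ∷ xs) c = trans (cong (_+_ c) (∑-const xs c)) (sym (ℤ.suc-* (+ length xs) c))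

  ∑-++ : ∀ (xs ys : List A) (f : A → ℤ) → ∑ (xs ++ ys) f ≡ ∑ xs f + ∑ ys f
  ∑-++ []       ys f = sym (ℤ.+-identityˡ _)
  ∑-++ (x ∷ xs) ys f = trans (cong (_+_ (f x)) (∑-++ xs ys f)) (sym (ℤ.+-assoc (f x) _ _))

  ∑-map : ∀ (h : A → B) (xs : List A) (f : B → ℤ) → ∑ (List.map h xs) f ≡ ∑[ x ∈ xs ] f (h x)
  ∑-map h []       f = refl
  ∑-map h (x ∷ xs) f = cong (_+_ (f (h x))) (∑-map h xs f)

  ∑-concatMap : ∀ (h : A → List B) (xs : List A) (f : B → ℤ) →
                ∑ (concatMap h xs) f ≡ ∑[ x ∈ xs ] ∑ (h x) f
  ∑-concatMap h []       f = refl
  ∑-concatMap h (x ∷ xs) f = trans (∑-++ (h x) _ f) (cong (_+_ (∑ (h x) f)) (∑-concatMap h xs f))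

  ∑-swap : ∀ (xs : List A) (ys : List B) (f : A → B → ℤ) →
           ∑[ x ∈ xs ] ∑[ y ∈ ys ] f x y ≡ ∑[ y ∈ ys ] ∑[ x ∈ xs ] f x y
  ∑-swap []       ys f = sym (trans (∑-const ys 0ℤ) (ℤ.*-zeroʳ (+ length ys)))
  ∑-swap (x ∷ xs) ys f =
    trans (cong (_+_ (∑ ys (f x))) (∑-swap xs ys f)) (sym (∑-distrib-+ ys (f x) _))

  ∑-nonNeg : ∀ (xs : List A) {f : A → ℤ} → (∀ x → 0ℤ ≤ f x) → 0ℤ ≤ ∑ xs f
  ∑-nonNeg []       0≤f = ℤ.≤-refl
  ∑-nonNeg (x ∷ xs) 0≤f = ℤ.+-mono-≤ (0≤f x) (∑-nonNeg xs 0≤f)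

  ∑-nonPos : ∀ {xs : List A} {f : A → ℤ} → All (λ x → f x ≤ 0ℤ) xs → ∑ xs f ≤ 0ℤ
  ∑-nonPos []           = ℤ.≤-refl
  ∑-nonPos (f≤0 ∷ f≤0s) = ℤ.+-mono-≤ f≤0 (∑-nonPos f≤0s)

  +sum≡∑ : ∀ (xs : List A) (f : A → ℕ) → + sum (List.map f xs) ≡ ∑[ x ∈ xs ] + f x
  +sum≡∑ []       f = refl
  +sum≡∑ (x ∷ xs) f = trans (ℤ.pos-+ (f x) _) (cong (_+_ (+ f x)) (+sum≡∑ xs f))

  0≤² : ∀ i → 0ℤ ≤ i ²
  0≤² (+ n)      = subst (0ℤ ≤_) (ℤ.pos-* n n) (ℤ.+≤+ ℕ.z≤n)
  0≤² ℤ.-[1+ n ] = ℤ.+≤+ ℕ.z≤n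

  ∑-deviation² : ∀ (xs : List A) (f : A → ℤ) (c : ℤ) →
                 ∑[ x ∈ xs ] (c - f x) ² ≡
                 + length xs * c ² - (c + c) * ∑ xs f + (∑[ x ∈ xs ] (f x) ²)
  ∑-deviation² xs f c = begin
    ∑[ x ∈ xs ] (c - f x) ²
      ≡⟨ ∑-cong xs (λ x → expand c (f x)) ⟩
    ∑[ x ∈ xs ] (c ² + - ((c + c) * f x) + (f x) ²)
      ≡⟨ ∑-distrib-+ xs _ _ ⟩
    (∑[ x ∈ xs ] c ² + - ((c + c) * f x)) + (∑[ x ∈ xs ] (f x) ²)
      ≡⟨ cong (_+ (∑[ x ∈ xs ] (f x) ²)) (∑-distrib-+ xs _ _) ⟩
    (∑[ x ∈ xs ] c ²) + (∑[ x ∈ xs ] - ((c + c) * f x)) + (∑[ x ∈ xs ] (f x) ²)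
      ≡⟨ cong₂ (λ u v → u + v + (∑[ x ∈ xs ] (f x) ²))
               (∑-const xs (c ²)) (trans (∑-neg xs _) (cong -_ (∑-*ˡ xs (c + c) f))) ⟩
    + length xs * c ² - (c + c) * ∑ xs f + (∑[ x ∈ xs ] (f x) ²) ∎
    where
    open ≡-Reasoning
    expand : ∀ c u → (c - u) * (c - u) ≡ c * c + - ((c + c) * u) + u * u
    expand = solve-∀

  cauchy-schwarz : ∀ (xs : List A) (f : A → ℤ) → (∑ xs f) ² ≤ + length xs * (∑[ x ∈ xs ] (f x) ²)
  cauchy-schwarz []       f = ℤ.≤-refl
  cauchy-schwarz (x ∷ xs) f = begin
    (c + S) ²
      ≡⟨ square-sum c S ⟩
    c ² + (c + c) * S + S ²
      ≤⟨ ℤ.+-monoʳ-≤ (c ² + (c + c) * S) (cauchy-schwarz xs f) ⟩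
    c ² + (c + c) * S + n * Q
      ≤⟨ ℤ.i≤i+j _ D {{ℤ.nonNegative (∑-nonNeg xs (λ y → 0≤² (c - f y)))}} ⟩
    c ² + (c + c) * S + n * Q + D
      ≡⟨ cong (_+_ (c ² + (c + c) * S + n * Q)) (∑-deviation² xs f c) ⟩
    c ² + (c + c) * S + n * Q + (n * c ² - (c + c) * S + Q)
      ≡⟨ regroup c S n Q ⟩
    (1ℤ + n) * (c ² + Q) ∎
    where
    open ℤ.≤-Reasoning
    c = f x
    S = ∑ xs f
    Q = ∑[ y ∈ xs ] (f y) ²
    D = ∑[ y ∈ xs ] (c - f y) ²
    n = + length xs
    square-sum : ∀ c s → (c + s) * (c + s) ≡ c * c + (c + c) * s + s * s
    square-sum = solve-∀
    regroup : ∀ c s n q →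
              c * c + (c + c) * s + n * q + (n * (c * c) - (c + c) * s + q) ≡ (1ℤ + n) * (c * c + q)
    regroup = solve-∀

  ∣m⊖n∣≡∣m-n∣ : ∀ m n → ℤ.∣ m ℤ.⊖ n ∣ ≡ ℕ.∣ m - n ∣
  ∣m⊖n∣≡∣m-n∣ m n with ℕ.≤-total m n
  ... | inj₁ m≤n = trans (ℤ.∣⊖∣-≤ m≤n) (sym (ℕ.m≤n⇒∣m-n∣≡n∸m m≤n))
  ... | inj₂ n≤m = trans (ℤ.∣m⊖n∣≡∣n⊖m∣ m n)
                     (trans (ℤ.∣⊖∣-≤ n≤m) (sym (trans (ℕ.∣-∣-comm m n) (ℕ.m≤n⇒∣m-n∣≡n∸m n≤m))))

  ∣m-n∣²≤-from-ℤ : ∀ m n c → (+ m - + n) ² ≤ + c → ℕ.∣ m - n ∣ ℕ.^ 2 ℕ.≤ c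
  ∣m-n∣²≤-from-ℤ m n c d²≤c = ℤ.drop‿+≤+ (subst (_≤ + c) d²≡∣m-n∣² d²≤c)
    where
    d = + m - + n
    d²≡∣m-n∣² : d ² ≡ + (ℕ.∣ m - n ∣ ℕ.^ 2)
    d²≡∣m-n∣² = begin
      d ²                              ≡⟨ ℤ.0≤i⇒+∣i∣≡i (0≤² d) ⟨
      + ℤ.∣ d ² ∣                      ≡⟨ cong +_ (ℤ.abs-* d d) ⟩
      + (ℤ.∣ d ∣ ℕ.* ℤ.∣ d ∣)          ≡⟨ cong (λ k → + (k ℕ.* k)) ∣d∣≡∣m-n∣ ⟩
      + (ℕ.∣ m - n ∣ ℕ.* ℕ.∣ m - n ∣)  ≡⟨ cong (λ k → + (ℕ.∣ m - n ∣ ℕ.* k)) (ℕ.*-identityʳ ℕ.∣ m - n ∣) ⟨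
      + (ℕ.∣ m - n ∣ ℕ.^ 2)            ∎
      where
      open ≡-Reasoning
      ∣d∣≡∣m-n∣ = trans (cong ℤ.∣_∣ (ℤ.m-n≡m⊖n m n)) (∣m⊖n∣≡∣m-n∣ m n)

  𝟙 : ∀ {p} {P : Set p} → Dec P → ℤ
  𝟙 P? = if does P? then 1ℤ else 0ℤ

  𝟙-⇔ : ∀ {p q} {P : Set p} {Q : Set q} → P ⇔ Q → (P? : Dec P) (Q? : Dec Q) → 𝟙 P? ≡ 𝟙 Q?
  𝟙-⇔ P⇔Q P? Q? = cong (if_then 1ℤ else 0ℤ) (does-⇔ P⇔Q P? Q?)

  𝟙-idem : ∀ {p} {P : Set p} (P? : Dec P) → 𝟙 P? * 𝟙 P? ≡ 𝟙 P?
  𝟙-idem (yes _) = refl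
  𝟙-idem (no _)  = refl

  module _ {c ℓ} (S : Setoid c ℓ) where
    open Setoid S renaming (Carrier to X; refl to ≈-refl; sym to ≈-sym; trans to ≈-trans)
    open UniqueSetoid S using (Unique)
    open MembershipSetoid S using (_∈_)
    open import Data.List.Relation.Binary.Subset.Setoid S using (_⊆_)

    ∑-─ : ∀ {f : X → ℤ} → f Preserves _≈_ ⟶ _≡_ → ∀ {x} ys (x∈ys : x ∈ ys) → ∑ ys f ≡ f x + ∑ (ys ─ x∈ys) f
    ∑-─ {f} f-resp (y ∷ ys) (here x≈y)   = cong (_+ ∑ ys f) (sym (f-resp x≈y))
    ∑-─ {f} f-resp (y ∷ ys) (there x∈ys) =
      trans (cong (_+_ (f y)) (∑-─ f-resp ys x∈ys)) (swap (f y) (f _) (∑ (ys ─ x∈ys) f))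
      where
      swap : ∀ a b c → a + (b + c) ≡ b + (a + c)
      swap = solve-∀

    ∈-─ : ∀ {x y ys} (x∈ys : x ∈ ys) → y ∈ ys → ¬ x ≈ y → y ∈ (ys ─ x∈ys)
    ∈-─ (here x≈z)   (here y≈z)   x≉y = ⊥-elim (x≉y (≈-trans x≈z (≈-sym y≈z)))
    ∈-─ (here _)     (there y∈ys) x≉y = y∈ys
    ∈-─ (there _)    (here y≈z)   x≉y = here y≈z
    ∈-─ (there x∈ys) (there y∈ys) x≉y = there (∈-─ x∈ys y∈ys x≉y)

    ∑-mono-⊆ : ∀ {f : X → ℤ} → (∀ x → 0ℤ ≤ f x) → f Preserves _≈_ ⟶ _≡_ →
               ∀ {xs ys} → Unique xs → xs ⊆ ys → ∑ xs f ≤ ∑ ys f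
    ∑-mono-⊆ 0≤f f-resp {[]}     {ys} _             _     = ∑-nonNeg ys 0≤f
    ∑-mono-⊆ {f} 0≤f f-resp {x ∷ xs} {ys} (x≉xs ∷ xs!) xs⊆ys = begin
      f x + ∑ xs f              ≤⟨ ℤ.+-monoʳ-≤ (f x) (∑-mono-⊆ 0≤f f-resp xs! xs⊆ys─x) ⟩
      f x + ∑ (ys ─ x∈ys) f     ≡⟨ sym (∑-─ f-resp ys x∈ys) ⟩
      ∑ ys f                    ∎
      where
      open ℤ.≤-Reasoning
      x∈ys : x ∈ ys
      x∈ys = xs⊆ys (here ≈-refl)
      xs⊆ys─x : xs ⊆ (ys ─ x∈ys)
      xs⊆ys─x y∈xs = ∈-─ x∈ys (xs⊆ys (there y∈xs))
        (λ x≈y → Allₚ.All¬⇒¬Any x≉xs (Membershipₚ.∈-resp-≈ S (≈-sym x≈y) y∈xs))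

    ∑∑-≤-diagonal : ∀ {K : X → X → ℤ} {B} → (∀ x → K x x ≤ B) → (∀ {x y} → ¬ x ≈ y → K x y ≤ 0ℤ) →
                    ∀ {xs} → Unique xs → (∑[ x ∈ xs ] ∑[ y ∈ xs ] K x y) ≤ + length xs * B
    ∑∑-≤-diagonal diag off {[]}     [] = ℤ.≤-refl
    ∑∑-≤-diagonal {K} {B} diag off {x ∷ xs} (x≉xs ∷ xs!) = begin
      K x x + ∑ xs (K x) + (∑[ y ∈ xs ] K y x + ∑ xs (K y))
        ≡⟨ cong (_+_ (K x x + ∑ xs (K x))) (∑-distrib-+ xs _ _) ⟩
      K x x + ∑ xs (K x) + ((∑[ y ∈ xs ] K y x) + (∑[ y ∈ xs ] ∑ xs (K y)))
        ≤⟨ ℤ.+-mono-≤ (ℤ.+-mono-≤ (diag x) (∑-nonPos (All.map off x≉xs)))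
                      (ℤ.+-mono-≤ (∑-nonPos (All.map (off ∘ (_∘ ≈-sym)) x≉xs))
                                  (∑∑-≤-diagonal diag off xs!)) ⟩
      B + 0ℤ + (0ℤ + + length xs * B)
        ≡⟨ drop-zeros B (+ length xs) ⟩
      B + + length xs * B
        ≡⟨ sym (ℤ.suc-* (+ length xs) B) ⟩
      + length (x ∷ xs) * B ∎
      where
      open ℤ.≤-Reasoning
      drop-zeros : ∀ b n → b + 0ℤ + (0ℤ + n * b) ≡ b + n * b
      drop-zeros = solve-∀

    module _ (≈? : Decidable _≈_) where

      ∑-𝟙-∉ : ∀ {x xs} → All (λ y → ¬ y ≈ x) xs → ∑[ y ∈ xs ] 𝟙 (≈? y x) ≡ 0ℤ
      ∑-𝟙-∉ []                    = refl
      ∑-𝟙-∉ {x} {y ∷ _} (y≉x ∷ ys≉x) with ≈? y x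
      ... | yes y≈x = ⊥-elim (y≉x y≈x)
      ... | no  _   = trans (ℤ.+-identityˡ _) (∑-𝟙-∉ ys≉x)

      ∑-𝟙-∈ : ∀ {x xs} → Unique xs → x ∈ xs → ∑[ y ∈ xs ] 𝟙 (≈? y x) ≡ 1ℤ
      ∑-𝟙-∈ {x} {y ∷ _} (y≉ys ∷ ys!) x∈y∷ys with ≈? y x | x∈y∷ys
      ... | yes y≈x | _          =
        cong (_+_ 1ℤ) (∑-𝟙-∉ (All.map (λ y≉z z≈x → y≉z (≈-trans y≈x (≈-sym z≈x))) y≉ys))
      ... | no  y≉x | here x≈y  = ⊥-elim (y≉x (≈-sym x≈y))
      ... | no  _   | there x∈ys = trans (ℤ.+-identityˡ _) (∑-𝟙-∈ ys! x∈ys)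

  +length≡∑1 : ∀ (xs : List A) → + length xs ≡ ∑[ x ∈ xs ] 1ℤ
  +length≡∑1 xs = sym (trans (∑-const xs 1ℤ) (ℤ.*-identityʳ (+ length xs)))

  +length-monomials-suc : ∀ m r →
    + length (monomials (suc m) r) ≡ ∑[ e ∈ List.upTo (suc r) ] + length (monomials m (r ℕ.∸ e))
  +length-monomials-suc m r = begin
    + length (monomials (suc m) r)
      ≡⟨ +length≡∑1 (monomials (suc m) r) ⟩
    ∑[ v ∈ monomials (suc m) r ] 1ℤ
      ≡⟨ ∑-concatMap block (List.upTo (suc r)) (λ _ → 1ℤ) ⟩
    ∑[ e ∈ List.upTo (suc r) ] ∑[ v ∈ block e ] 1ℤ
      ≡⟨ ∑-cong (List.upTo (suc r)) count-block ⟩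
    ∑[ e ∈ List.upTo (suc r) ] + length (monomials m (r ℕ.∸ e)) ∎
    where
    open ≡-Reasoning
    block : ℕ → List (Vec ℕ (suc m))
    block e = List.map (e ∷_) (monomials m (r ℕ.∸ e))
    count-block : ∀ e → ∑[ v ∈ block e ] 1ℤ ≡ + length (monomials m (r ℕ.∸ e))
    count-block e =
      trans (∑-map (e ∷_) (monomials m (r ℕ.∸ e)) (λ _ → 1ℤ)) (sym (+length≡∑1 (monomials m (r ℕ.∸ e))))

  length-monomials-pascal : ∀ m r →
    length (monomials (suc m) (suc r)) ≡ length (monomials m (suc r)) ℕ.+ length (monomials (suc m) r)
  length-monomials-pascal m r = ℤ.+-injective (begin
    + length (monomials (suc m) (suc r))
      ≡⟨ +length-monomials-suc m (suc r) ⟩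
    N₀ + (∑[ e ∈ List.applyUpTo suc (suc r) ] N e)
      ≡⟨ cong (λ es → N₀ + ∑ es N) (sym (Listₚ.map-applyUpTo (λ i → i) suc (suc r))) ⟩
    N₀ + (∑[ e ∈ List.map suc (List.upTo (suc r)) ] N e)
      ≡⟨ cong (_+_ N₀) (trans (∑-map suc (List.upTo (suc r)) N) (sym (+length-monomials-suc m r))) ⟩
    N₀ + + length (monomials (suc m) r)
      ≡⟨ ℤ.pos-+ (length (monomials m (suc r))) _ ⟨
    + (length (monomials m (suc r)) ℕ.+ length (monomials (suc m) r)) ∎)
    where
    open ≡-Reasoning
    N₀ = + length (monomials m (suc r))
    N : ℕ → ℤ
    N e = + length (monomials m (suc r ℕ.∸ e))

  length-monomials : ∀ m r → length (monomials m r) ≡ (m ℕ.+ r) C r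
  length-monomials zero    r       = sym (nCn≡1 r)
  length-monomials (suc m) zero    = ℤ.+-injective (trans (+length-monomials-suc m 0)
                                       (trans (ℤ.+-identityʳ _) (cong +_ (length-monomials m 0))))
  length-monomials (suc m) (suc r) = begin
    length (monomials (suc m) (suc r))
      ≡⟨ length-monomials-pascal m r ⟩
    length (monomials m (suc r)) ℕ.+ length (monomials (suc m) r)
      ≡⟨ cong₂ ℕ._+_ (length-monomials m (suc r)) (length-monomials (suc m) r) ⟩
    (m ℕ.+ suc r) C suc r ℕ.+ n C r
      ≡⟨ cong (λ k → k C suc r ℕ.+ n C r) (ℕ.+-suc m r) ⟩
    n C suc r ℕ.+ n C r
      ≡⟨ ℕ.+-comm (n C suc r) (n C r) ⟩
    n C r ℕ.+ n C suc r
      ≡⟨ nCk+nC[k+1]≡[n+1]C[k+1] n r ⟩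
    suc n C suc r
      ≡⟨ cong (λ k → suc k C suc r) (ℕ.+-suc m r) ⟨
    (suc m ℕ.+ suc r) C suc r ∎
    where
    open ≡-Reasoning
    n = suc (m ℕ.+ r)

  monomials-head : ∀ m r → ∃ λ es → monomials m r ≡ Vec.replicate m 0 ∷ es
  monomials-head zero    r = [] , refl
  monomials-head (suc m) r with monomials-head m r
  ... | es , eq = _ , cong (λ ms → List.map (0 ∷_) ms ++ concatMap block (List.applyUpTo suc r)) eq
    where
    block : ℕ → List (Vec ℕ (suc m))
    block e = List.map (e ∷_) (monomials m (r ℕ.∸ e))

  module _ {c ℓ} (F : FiniteField c ℓ) where
    open FiniteField F
      using (Carrier; _≈_; _≟_; 0#; 1#; setoid; elements; complete; distinct; inverse; order;
             +-cong; *-cong; +-comm; *-comm; *-assoc; *-identityˡ; *-identityʳ; -‿inverseʳ;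
             +-group; +-abelianGroup; +-commutativeSemigroup; ring)
      renaming (_+_ to _⊕_; _*_ to _⊛_; _-_ to _⊖_; -_ to ⊝_; refl to ≈-refl; sym to ≈-sym; trans to ≈-trans)
    open import Algebra.Properties.Group +-group using (x≈z//y; //-rightDividesˡ; x∙y⁻¹≈ε⇒x≈y)
    open import Algebra.Properties.AbelianGroup +-abelianGroup using (⁻¹-∙-comm)
    open import Algebra.Properties.CommutativeSemigroup +-commutativeSemigroup using (interchange; xy∙z≈zy∙x)
    open import Algebra.Properties.Ring ring using (x[y-z]≈xy-xz)
    open VecEquality setoid using (_≋_; ≋-setoid; ≋-refl; ≋-sym)

    private
      q : ℕ
      q = order

    ≈ˡ-⇔ : ∀ {x x′ z} → x ≈ x′ → x ≈ z ⇔ x′ ≈ z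
    ≈ˡ-⇔ x≈x′ = mk⇔ (≈-trans (≈-sym x≈x′)) (≈-trans x≈x′)

    count-≈ : ∀ x → ∑[ y ∈ elements ] 𝟙 (y ≟ x) ≡ 1ℤ
    count-≈ x = ∑-𝟙-∈ setoid _≟_ distinct (complete x)

    sift : ∀ {φ : Carrier → ℤ} → φ Preserves _≈_ ⟶ _≡_ → ∀ x → ∑[ a ∈ elements ] 𝟙 (a ≟ x) * φ a ≡ φ x
    sift {φ} φ-resp x = begin
      ∑[ a ∈ elements ] 𝟙 (a ≟ x) * φ a   ≡⟨ ∑-cong elements pointwise ⟩
      ∑[ a ∈ elements ] φ x * 𝟙 (a ≟ x)   ≡⟨ ∑-*ˡ elements (φ x) _ ⟩
      φ x * (∑[ a ∈ elements ] 𝟙 (a ≟ x)) ≡⟨ cong (_*_ (φ x)) (count-≈ x) ⟩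
      φ x * 1ℤ                            ≡⟨ ℤ.*-identityʳ (φ x) ⟩
      φ x                                 ∎
      where
      open ≡-Reasoning
      pointwise : ∀ a → 𝟙 (a ≟ x) * φ a ≡ φ x * 𝟙 (a ≟ x)
      pointwise a with a ≟ x
      ... | yes a≈x = trans (ℤ.*-identityˡ (φ a)) (trans (φ-resp a≈x) (sym (ℤ.*-identityʳ (φ x))))
      ... | no  _   = sym (ℤ.*-zeroʳ (φ x))

    count-unique-solution : ∀ {p} {P : Carrier → Set p} (P? : ∀ a → Dec (P a)) x →
                            (∀ a → P a ⇔ a ≈ x) → ∑[ a ∈ elements ] 𝟙 (P? a) ≡ 1ℤ
    count-unique-solution P? x P⇔≈x =
      trans (∑-cong elements (λ a → 𝟙-⇔ (P⇔≈x a) (P? a) (a ≟ x))) (count-≈ x)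

    ⊕-solveˡ : ∀ {a s y} → a ⊕ s ≈ y ⇔ a ≈ y ⊖ s
    ⊕-solveˡ {a} {s} {y} =
      mk⇔ (x≈z//y a s y) (λ a≈y-s → ≈-trans (+-cong a≈y-s ≈-refl) (//-rightDividesˡ s y))

    ⊕-solveʳ : ∀ {s a y} → s ⊕ a ≈ y ⇔ a ≈ y ⊖ s
    ⊕-solveʳ {s} {a} = ⊕-solveˡ ⇔-∘ ≈ˡ-⇔ (+-comm s a)

    ⊛-solve : ∀ {w} → ¬ w ≈ 0# → ∃ λ w⁻¹ → ∀ {a d} → a ⊛ w ≈ d ⇔ a ≈ d ⊛ w⁻¹
    ⊛-solve {w} w≉0 with inverse w w≉0
    ... | w⁻¹ , ww⁻¹≈1 = w⁻¹ , mk⇔ to from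
      where
      open ≈-Reasoning setoid
      to : ∀ {a d} → a ⊛ w ≈ d → a ≈ d ⊛ w⁻¹
      to {a} {d} aw≈d = begin
        a                ≈⟨ *-identityʳ a ⟨
        a ⊛ 1#           ≈⟨ *-cong ≈-refl ww⁻¹≈1 ⟨
        a ⊛ (w ⊛ w⁻¹)    ≈⟨ *-assoc a w w⁻¹ ⟨
        (a ⊛ w) ⊛ w⁻¹    ≈⟨ *-cong aw≈d ≈-refl ⟩
        d ⊛ w⁻¹          ∎
      from : ∀ {a d} → a ≈ d ⊛ w⁻¹ → a ⊛ w ≈ d
      from {a} {d} a≈dw⁻¹ = begin
        a ⊛ w            ≈⟨ *-cong a≈dw⁻¹ ≈-refl ⟩
        (d ⊛ w⁻¹) ⊛ w    ≈⟨ *-assoc d w⁻¹ w ⟩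
        d ⊛ (w⁻¹ ⊛ w)    ≈⟨ *-cong ≈-refl (≈-trans (*-comm w⁻¹ w) ww⁻¹≈1) ⟩
        d ⊛ 1#           ≈⟨ *-identityʳ d ⟩
        d                ∎

    vectors : (k : ℕ) → List (Vec Carrier k)
    vectors zero    = [] ∷ []
    vectors (suc k) = concatMap (λ a → List.map (a ∷_) (vectors k)) elements

    ∑-vectors : ∀ k (φ : Vec Carrier (suc k) → ℤ) →
                ∑ (vectors (suc k)) φ ≡ ∑[ a ∈ elements ] ∑[ g ∈ vectors k ] φ (a ∷ g)
    ∑-vectors k φ =
      trans (∑-concatMap _ elements φ) (∑-cong elements (λ a → ∑-map (a ∷_) (vectors k) φ))

    ∑-vectors-1 : ∀ k → ∑[ g ∈ vectors k ] 1ℤ ≡ + (q ℕ.^ k)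
    ∑-vectors-1 zero    = refl
    ∑-vectors-1 (suc k) = begin
      ∑[ g ∈ vectors (suc k) ] 1ℤ               ≡⟨ ∑-vectors k _ ⟩
      ∑[ a ∈ elements ] ∑[ g ∈ vectors k ] 1ℤ   ≡⟨ ∑-cong elements (λ _ → ∑-vectors-1 k) ⟩
      ∑[ a ∈ elements ] + (q ℕ.^ k)             ≡⟨ ∑-const elements _ ⟩
      + q * + (q ℕ.^ k)                         ≡⟨ ℤ.pos-* q _ ⟨
      + (q ℕ.^ suc k)                           ∎
      where open ≡-Reasoning

    vectors-complete : ∀ {k} (g : Vec Carrier k) → Any (g ≋_) (vectors k)
    vectors-complete []      = here []
    vectors-complete (a ∷ g) =
      Anyₚ.concat⁺ (Anyₚ.map⁺ (Any.map (λ a≈b → Anyₚ.map⁺ (Any.map (a≈b ∷_) (vectors-complete g)))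
                                       (complete a)))

    infix 7 _·_
    _·_ : ∀ {k} → Vec Carrier k → Vec Carrier k → Carrier
    []       · []       = 0#
    (a ∷ as) · (b ∷ bs) = a ⊛ b ⊕ as · bs

    ·-cong : ∀ {k} {f f′ u u′ : Vec Carrier k} → f ≋ f′ → u ≋ u′ → f · u ≈ f′ · u′
    ·-cong []            []            = ≈-refl
    ·-cong (a≈a′ ∷ f≋f′) (b≈b′ ∷ u≋u′) = +-cong (*-cong a≈a′ b≈b′) (·-cong f≋f′ u≋u′)

    ·-distribˡ-⊖ : ∀ {k} (g a b : Vec Carrier k) → g · Vec.zipWith _⊖_ b a ≈ g · b ⊖ g · a
    ·-distribˡ-⊖ []      []       []       = ≈-sym (-‿inverseʳ 0#)
    ·-distribˡ-⊖ (x ∷ g) (a ∷ as) (b ∷ bs) = begin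
      x ⊛ (b ⊖ a) ⊕ g · Vec.zipWith _⊖_ bs as   ≈⟨ +-cong (x[y-z]≈xy-xz x b a) (·-distribˡ-⊖ g as bs) ⟩
      (x ⊛ b ⊖ x ⊛ a) ⊕ (g · bs ⊖ g · as)       ≈⟨ interchange (x ⊛ b) (⊝ (x ⊛ a)) (g · bs) (⊝ (g · as)) ⟩
      (x ⊛ b ⊕ g · bs) ⊕ (⊝ (x ⊛ a) ⊕ ⊝ (g · as)) ≈⟨ +-cong ≈-refl (⁻¹-∙-comm (x ⊛ a) (g · as)) ⟩
      (x ⊛ b ⊕ g · bs) ⊖ (x ⊛ a ⊕ g · as)       ∎
      where open ≈-Reasoning setoid

    ≉⇒difference≉0 : ∀ {k} {a b : Vec Carrier k} → ¬ a ≋ b →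
                     VecAny.Any (λ z → ¬ z ≈ 0#) (Vec.zipWith _⊖_ b a)
    ≉⇒difference≉0 {a = []}    {[]}    a≉b = ⊥-elim (a≉b [])
    ≉⇒difference≉0 {a = x ∷ a} {y ∷ b} a≉b with x ≟ y
    ... | yes x≈y = VecAny.there (≉⇒difference≉0 (λ a≋b → a≉b (x≈y ∷ a≋b)))
    ... | no  x≉y = VecAny.here (λ y-x≈0 → x≉y (≈-sym (x∙y⁻¹≈ε⇒x≈y y x y-x≈0)))

    count-translate : ∀ s y → ∑[ a ∈ elements ] 𝟙 ((a ⊕ s) ≟ y) ≡ 1ℤ
    count-translate s y = count-unique-solution (λ a → (a ⊕ s) ≟ y) (y ⊖ s) (λ _ → ⊕-solveˡ)

    count-affine : ∀ {w} → ¬ w ≈ 0# → ∀ s y → ∑[ a ∈ elements ] 𝟙 ((a ⊛ w ⊕ s) ≟ y) ≡ 1ℤ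
    count-affine {w} w≉0 s y with ⊛-solve w≉0
    ... | w⁻¹ , ⊛-solve′ =
      count-unique-solution (λ a → (a ⊛ w ⊕ s) ≟ y) ((y ⊖ s) ⊛ w⁻¹) (λ _ → ⊛-solve′ ⇔-∘ ⊕-solveˡ)

    count-linear : ∀ {k} (w : Vec Carrier k) y → VecAny.Any (λ z → ¬ z ≈ 0#) w →
                   + q * (∑[ g ∈ vectors k ] 𝟙 ((g · w) ≟ y)) ≡ + (q ℕ.^ k)
    count-linear {suc k} (w₀ ∷ w) y (VecAny.here w₀≉0) = begin
      + q * (∑[ g ∈ vectors (suc k) ] 𝟙 ((g · (w₀ ∷ w)) ≟ y))
        ≡⟨ cong (_*_ (+ q)) (trans (∑-vectors k _) (∑-swap elements (vectors k) _)) ⟩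
      + q * (∑[ g ∈ vectors k ] ∑[ a ∈ elements ] 𝟙 ((a ⊛ w₀ ⊕ g · w) ≟ y))
        ≡⟨ cong (_*_ (+ q)) (∑-cong (vectors k) (λ g → count-affine w₀≉0 (g · w) y)) ⟩
      + q * (∑[ g ∈ vectors k ] 1ℤ)
        ≡⟨ cong (_*_ (+ q)) (∑-vectors-1 k) ⟩
      + q * + (q ℕ.^ k)
        ≡⟨ ℤ.pos-* q _ ⟨
      + (q ℕ.^ suc k) ∎
      where open ≡-Reasoning
    count-linear {suc k} (w₀ ∷ w) y (VecAny.there w≉0) = begin
      + q * (∑[ g ∈ vectors (suc k) ] 𝟙 ((g · (w₀ ∷ w)) ≟ y))
        ≡⟨ cong (_*_ (+ q)) (∑-vectors k _) ⟩
      + q * (∑[ a ∈ elements ] ∑[ g ∈ vectors k ] 𝟙 ((a ⊛ w₀ ⊕ g · w) ≟ y))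
        ≡⟨ ∑-*ˡ elements (+ q) _ ⟨
      ∑[ a ∈ elements ] + q * (∑[ g ∈ vectors k ] 𝟙 ((a ⊛ w₀ ⊕ g · w) ≟ y))
        ≡⟨ ∑-cong elements (λ a → cong (_*_ (+ q)) (∑-cong (vectors k) (λ g →
             𝟙-⇔ ⊕-solveʳ ((a ⊛ w₀ ⊕ g · w) ≟ y) ((g · w) ≟ (y ⊖ a ⊛ w₀))))) ⟩
      ∑[ a ∈ elements ] + q * (∑[ g ∈ vectors k ] 𝟙 ((g · w) ≟ (y ⊖ a ⊛ w₀)))
        ≡⟨ ∑-cong elements (λ a → count-linear w (y ⊖ a ⊛ w₀) w≉0) ⟩
      ∑[ a ∈ elements ] + (q ℕ.^ k)
        ≡⟨ ∑-const elements _ ⟩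
      + q * + (q ℕ.^ k)
        ≡⟨ ℤ.pos-* q _ ⟨
      + (q ℕ.^ suc k) ∎
      where open ≡-Reasoning

    -- (a , y) stands for the hyperplane f₀ + g · a = y of points f₀ ∷ g ∈ 𝔽^(k+1). Fixing the
    -- first coefficient of the normal to 1 loses nothing for graphs of polynomials, and makes
    -- two distinct hyperplanes either parallel or meet in codimension 2.
    Hyperplane : ℕ → Set c
    Hyperplane k = Vec Carrier k × Carrier

    hyperplaneSetoid : ℕ → Setoid c (c ⊔ ℓ)
    hyperplaneSetoid k = ×-setoid (≋-setoid k) setoid

    infix 4 _≈ₕ_
    _≈ₕ_ : ∀ {k} → Hyperplane k → Hyperplane k → Set (c ⊔ ℓ)
    _≈ₕ_ {k} = Setoid._≈_ (hyperplaneSetoid k)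

    infix 4 _∈ₕ_ _∈ₕ?_
    _∈ₕ_ : ∀ {k} → Vec Carrier (suc k) → Hyperplane k → Set ℓ
    (f₀ ∷ g) ∈ₕ (a , y) = f₀ ⊕ g · a ≈ y

    _∈ₕ?_ : ∀ {k} (f : Vec Carrier (suc k)) (h : Hyperplane k) → Dec (f ∈ₕ h)
    (f₀ ∷ g) ∈ₕ? (a , y) = (f₀ ⊕ g · a) ≟ y

    ∈ₕ-resp-≋ : ∀ {k} {f f′ : Vec Carrier (suc k)} {h} → f ≋ f′ → f ∈ₕ h → f′ ∈ₕ h
    ∈ₕ-resp-≋ (f₀≈f₀′ ∷ g≋g′) = ≈-trans (+-cong (≈-sym f₀≈f₀′) (·-cong (≋-sym g≋g′) ≋-refl))

    𝟙-∈ₕ-cong : ∀ {k} {f f′ : Vec Carrier (suc k)} h → f ≋ f′ → 𝟙 (f ∈ₕ? h) ≡ 𝟙 (f′ ∈ₕ? h)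
    𝟙-∈ₕ-cong {f = f} {f′} h f≋f′ =
      𝟙-⇔ (mk⇔ (∈ₕ-resp-≋ f≋f′) (∈ₕ-resp-≋ (≋-sym f≋f′))) (f ∈ₕ? h) (f′ ∈ₕ? h)

    ∑-hyperplane : ∀ {k} (h : Hyperplane k) →
                   ∑[ f ∈ vectors (suc k) ] 𝟙 (f ∈ₕ? h) ≡ + (q ℕ.^ k)
    ∑-hyperplane {k} (a , y) = begin
      ∑[ f ∈ vectors (suc k) ] 𝟙 (f ∈ₕ? (a , y))
        ≡⟨ trans (∑-vectors k _) (∑-swap elements (vectors k) _) ⟩
      ∑[ g ∈ vectors k ] ∑[ f₀ ∈ elements ] 𝟙 ((f₀ ⊕ g · a) ≟ y)
        ≡⟨ ∑-cong (vectors k) (λ g → count-translate (g · a) y) ⟩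
      ∑[ g ∈ vectors k ] 1ℤ
        ≡⟨ ∑-vectors-1 k ⟩
      + (q ℕ.^ k) ∎
      where open ≡-Reasoning

    intersection : ∀ {k} → Hyperplane k → Hyperplane k → ℤ
    intersection {k} h h′ = ∑[ f ∈ vectors (suc k) ] 𝟙 (f ∈ₕ? h) * 𝟙 (f ∈ₕ? h′)

    intersection-self : ∀ {k} (h : Hyperplane k) → intersection h h ≡ + (q ℕ.^ k)
    intersection-self {k} h =
      trans (∑-cong (vectors (suc k)) (λ f → 𝟙-idem (f ∈ₕ? h))) (∑-hyperplane h)

    intersection-nonparallel : ∀ {k} {a a′ : Vec Carrier k} y y′ → ¬ a ≋ a′ →
                               + q * intersection (a , y) (a′ , y′) ≡ + (q ℕ.^ k)
    intersection-nonparallel {k} {a} {a′} y y′ a≉a′ = begin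
      + q * intersection (a , y) (a′ , y′)
        ≡⟨ cong (_*_ (+ q)) (trans (∑-vectors k _) (∑-swap elements (vectors k) _)) ⟩
      + q * (∑[ g ∈ vectors k ] ∑[ f₀ ∈ elements ] 𝟙 ((f₀ ⊕ g · a) ≟ y) * 𝟙 ((f₀ ⊕ g · a′) ≟ y′))
        ≡⟨ cong (_*_ (+ q)) (∑-cong (vectors k) (λ g → ∑-cong elements (λ f₀ →
             cong (_* 𝟙 ((f₀ ⊕ g · a′) ≟ y′)) (𝟙-⇔ ⊕-solveˡ ((f₀ ⊕ g · a) ≟ y) (f₀ ≟ (y ⊖ g · a)))))) ⟩
      + q * (∑[ g ∈ vectors k ] ∑[ f₀ ∈ elements ] 𝟙 (f₀ ≟ (y ⊖ g · a)) * 𝟙 ((f₀ ⊕ g · a′) ≟ y′))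
        ≡⟨ cong (_*_ (+ q)) (∑-cong (vectors k) (λ g → sift (𝟙-⊕-cong (g · a′)) (y ⊖ g · a))) ⟩
      + q * (∑[ g ∈ vectors k ] 𝟙 (((y ⊖ g · a) ⊕ g · a′) ≟ y′))
        ≡⟨ cong (_*_ (+ q)) (∑-cong (vectors k) (λ g →
             𝟙-⇔ (meet g) (((y ⊖ g · a) ⊕ g · a′) ≟ y′) ((g · Vec.zipWith _⊖_ a′ a) ≟ (y′ ⊖ y)))) ⟩
      + q * (∑[ g ∈ vectors k ] 𝟙 ((g · Vec.zipWith _⊖_ a′ a) ≟ (y′ ⊖ y)))
        ≡⟨ count-linear (Vec.zipWith _⊖_ a′ a) (y′ ⊖ y) (≉⇒difference≉0 a≉a′) ⟩
      + (q ℕ.^ k) ∎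
      where
      open ≡-Reasoning
      𝟙-⊕-cong : ∀ s → (λ f₀ → 𝟙 ((f₀ ⊕ s) ≟ y′)) Preserves _≈_ ⟶ _≡_
      𝟙-⊕-cong s {f₀} {f₀′} f₀≈f₀′ = 𝟙-⇔ (≈ˡ-⇔ (+-cong f₀≈f₀′ ≈-refl)) ((f₀ ⊕ s) ≟ y′) ((f₀′ ⊕ s) ≟ y′)
      meet : ∀ g → (y ⊖ g · a) ⊕ g · a′ ≈ y′ ⇔ g · Vec.zipWith _⊖_ a′ a ≈ y′ ⊖ y
      meet g = ≈ˡ-⇔ (≈-sym (·-distribˡ-⊖ g a a′)) ⇔-∘ (⊕-solveˡ ⇔-∘ ≈ˡ-⇔ (xy∙z≈zy∙x y (⊝ (g · a)) (g · a′)))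

    intersection-parallel : ∀ {k} {a a′ : Vec Carrier k} {y y′} → a ≋ a′ → ¬ y ≈ y′ →
                            intersection (a , y) (a′ , y′) ≡ 0ℤ
    intersection-parallel {k} {a} {a′} {y} {y′} a≋a′ y≉y′ =
      trans (∑-cong V disjoint) (trans (∑-const V 0ℤ) (ℤ.*-zeroʳ (+ length V)))
      where
      V = vectors (suc k)
      disjoint : ∀ f → 𝟙 (f ∈ₕ? (a , y)) * 𝟙 (f ∈ₕ? (a′ , y′)) ≡ 0ℤ
      disjoint (f₀ ∷ g) with (f₀ ⊕ g · a) ≟ y | (f₀ ⊕ g · a′) ≟ y′
      ... | yes f∈h | yes f∈h′ =
        ⊥-elim (y≉y′ (≈-trans (≈-sym f∈h) (≈-trans (+-cong ≈-refl (·-cong (≋-refl {x = g}) a≋a′)) f∈h′)))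
      ... | yes _   | no _     = refl
      ... | no _    | _        = refl

    centred : ∀ {k} → Hyperplane k → Vec Carrier (suc k) → ℤ
    centred h f = + q * 𝟙 (f ∈ₕ? h) - 1ℤ

    ∑-centred : ∀ {k} (h : Hyperplane k) → ∑[ f ∈ vectors (suc k) ] centred h f ≡ 0ℤ
    ∑-centred {k} h = begin
      ∑[ f ∈ V ] centred h f
        ≡⟨ ∑-linear V (+ q) _ _ ⟩
      + q * (∑[ f ∈ V ] 𝟙 (f ∈ₕ? h)) - (∑[ f ∈ V ] 1ℤ)
        ≡⟨ cong₂ _-_ (cong (_*_ (+ q)) (∑-hyperplane h)) (∑-vectors-1 (suc k)) ⟩
      + q * + (q ℕ.^ k) - + (q ℕ.^ suc k)
        ≡⟨ cong (_- + (q ℕ.^ suc k)) (ℤ.pos-* q _) ⟨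
      + (q ℕ.^ suc k) - + (q ℕ.^ suc k)
        ≡⟨ ℤ.+-inverseʳ (+ (q ℕ.^ suc k)) ⟩
      0ℤ ∎
      where
      open ≡-Reasoning
      V = vectors (suc k)

    correlation : ∀ {k} → Hyperplane k → Hyperplane k → ℤ
    correlation {k} h h′ = ∑[ f ∈ vectors (suc k) ] centred h f * centred h′ f

    correlation≡ : ∀ {k} (h h′ : Hyperplane k) →
                   correlation h h′ ≡ + q * (+ q * intersection h h′ - + (q ℕ.^ k))
    correlation≡ {k} h h′ = begin
      ∑[ f ∈ V ] centred h f * centred h′ f
        ≡⟨ ∑-cong V (λ f → unfoldˡ (+ q) (𝟙 (f ∈ₕ? h)) (centred h′ f)) ⟩
      ∑[ f ∈ V ] (+ q * (𝟙 (f ∈ₕ? h) * centred h′ f) - centred h′ f)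
        ≡⟨ ∑-linear V (+ q) _ _ ⟩
      + q * (∑[ f ∈ V ] 𝟙 (f ∈ₕ? h) * centred h′ f) - (∑[ f ∈ V ] centred h′ f)
        ≡⟨ cong₂ (λ u v → + q * u - v) weighted (∑-centred h′) ⟩
      + q * (+ q * intersection h h′ - + (q ℕ.^ k)) - 0ℤ
        ≡⟨ ℤ.+-identityʳ _ ⟩
      + q * (+ q * intersection h h′ - + (q ℕ.^ k)) ∎
      where
      open ≡-Reasoning
      V = vectors (suc k)
      unfoldˡ : ∀ q a t → (q * a - 1ℤ) * t ≡ q * (a * t) - t
      unfoldˡ = solve-∀
      unfoldʳ : ∀ q a b → a * (q * b - 1ℤ) ≡ q * (a * b) - a
      unfoldʳ = solve-∀
      weighted : ∑[ f ∈ V ] 𝟙 (f ∈ₕ? h) * centred h′ f ≡ + q * intersection h h′ - + (q ℕ.^ k)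
      weighted = begin
        ∑[ f ∈ V ] 𝟙 (f ∈ₕ? h) * centred h′ f
          ≡⟨ ∑-cong V (λ f → unfoldʳ (+ q) (𝟙 (f ∈ₕ? h)) (𝟙 (f ∈ₕ? h′))) ⟩
        ∑[ f ∈ V ] (+ q * (𝟙 (f ∈ₕ? h) * 𝟙 (f ∈ₕ? h′)) - 𝟙 (f ∈ₕ? h))
          ≡⟨ ∑-linear V (+ q) _ _ ⟩
        + q * intersection h h′ - (∑[ f ∈ V ] 𝟙 (f ∈ₕ? h))
          ≡⟨ cong (_-_ (+ q * intersection h h′)) (∑-hyperplane h) ⟩
        + q * intersection h h′ - + (q ℕ.^ k) ∎

    correlation-self : ∀ {k} (h : Hyperplane k) → correlation h h ≤ + (q ℕ.^ (suc k ℕ.+ 1))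
    correlation-self {k} h = begin
      correlation h h
        ≡⟨ correlation≡ h h ⟩
      + q * (+ q * intersection h h - + (q ℕ.^ k))
        ≡⟨ cong (λ i → + q * (+ q * i - + (q ℕ.^ k))) (intersection-self h) ⟩
      + q * (+ q * + (q ℕ.^ k) - + (q ℕ.^ k))
        ≤⟨ ℤ.*-monoˡ-≤-nonNeg (+ q) (ℤ.i-j≤i (+ q * + (q ℕ.^ k)) (+ (q ℕ.^ k))) ⟩
      + q * (+ q * + (q ℕ.^ k))
        ≡⟨ trans (ℤ.pos-* q _) (cong (_*_ (+ q)) (ℤ.pos-* q _)) ⟨
      + (q ℕ.^ (2 ℕ.+ k))
        ≡⟨ cong (+_ ∘ (q ℕ.^_)) (ℕ.+-comm 1 (suc k)) ⟩
      + (q ℕ.^ (suc k ℕ.+ 1)) ∎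
      where open ℤ.≤-Reasoning

    correlation-distinct : ∀ {k} {h h′ : Hyperplane k} → ¬ h ≈ₕ h′ → correlation h h′ ≤ 0ℤ
    correlation-distinct {k} {a , y} {a′ , y′} h≉h′ with Pointwise.decidable _≟_ a a′
    ... | yes a≋a′ = begin
      correlation (a , y) (a′ , y′)
        ≡⟨ correlation≡ (a , y) (a′ , y′) ⟩
      + q * (+ q * intersection (a , y) (a′ , y′) - + (q ℕ.^ k))
        ≡⟨ cong (λ i → + q * (+ q * i - + (q ℕ.^ k))) (intersection-parallel a≋a′ (h≉h′ ∘ (a≋a′ ,_))) ⟩
      + q * (+ q * 0ℤ - + (q ℕ.^ k))
        ≤⟨ ℤ.*-monoˡ-≤-nonNeg (+ q) (ℤ.i-j≤i (+ q * 0ℤ) (+ (q ℕ.^ k))) ⟩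
      + q * (+ q * 0ℤ)
        ≡⟨ trans (cong (_*_ (+ q)) (ℤ.*-zeroʳ (+ q))) (ℤ.*-zeroʳ (+ q)) ⟩
      0ℤ ∎
      where open ℤ.≤-Reasoning
    ... | no a≉a′ = ℤ.≤-reflexive (begin
      correlation (a , y) (a′ , y′)
        ≡⟨ correlation≡ (a , y) (a′ , y′) ⟩
      + q * (+ q * intersection (a , y) (a′ , y′) - + (q ℕ.^ k))
        ≡⟨ cong (λ i → + q * (i - + (q ℕ.^ k))) (intersection-nonparallel y y′ a≉a′) ⟩
      + q * (+ (q ℕ.^ k) - + (q ℕ.^ k))
        ≡⟨ cong (_*_ (+ q)) (ℤ.+-inverseʳ (+ (q ℕ.^ k))) ⟩
      + q * 0ℤ
        ≡⟨ ℤ.*-zeroʳ (+ q) ⟩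
      0ℤ ∎)
      where open ≡-Reasoning

    incidencesₕ : ∀ {k} → List (Hyperplane k) → List (Vec Carrier (suc k)) → ℤ
    incidencesₕ H L = ∑[ h ∈ H ] ∑[ f ∈ L ] 𝟙 (f ∈ₕ? h)

    discrepancy : ∀ {k} → List (Hyperplane k) → Vec Carrier (suc k) → ℤ
    discrepancy H f = ∑[ h ∈ H ] centred h f

    incidences-discrepancy : ∀ {k} (H : List (Hyperplane k)) L →
                             + q * incidencesₕ H L - + length H * + length L ≡ ∑[ f ∈ L ] discrepancy H f
    incidences-discrepancy H L = sym (begin
      ∑[ f ∈ L ] ∑[ h ∈ H ] (+ q * 𝟙 (f ∈ₕ? h) - 1ℤ)
        ≡⟨ ∑-cong L (λ f → trans (∑-linear H (+ q) _ _)
                                  (cong (_-_ (+ q * (∑[ h ∈ H ] 𝟙 (f ∈ₕ? h)))) (∑-const H 1ℤ))) ⟩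
      ∑[ f ∈ L ] (+ q * (∑[ h ∈ H ] 𝟙 (f ∈ₕ? h)) - + length H * 1ℤ)
        ≡⟨ ∑-linear L (+ q) _ _ ⟩
      + q * (∑[ f ∈ L ] ∑[ h ∈ H ] 𝟙 (f ∈ₕ? h)) - (∑[ f ∈ L ] + length H * 1ℤ)
        ≡⟨ cong₂ (λ i n → + q * i - n) (∑-swap L H _) (∑-const L _) ⟩
      + q * incidencesₕ H L - + length L * (+ length H * 1ℤ)
        ≡⟨ cong (_-_ (+ q * incidencesₕ H L)) (count-pairs (+ length L) (+ length H)) ⟩
      + q * incidencesₕ H L - + length H * + length L ∎)
      where
      open ≡-Reasoning
      count-pairs : ∀ l n → l * (n * 1ℤ) ≡ n * l
      count-pairs = solve-∀

    ∑-discrepancy² : ∀ {k} (H : List (Hyperplane k)) →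
                     ∑[ f ∈ vectors (suc k) ] (discrepancy H f) ² ≡ ∑[ h ∈ H ] ∑[ h′ ∈ H ] correlation h h′
    ∑-discrepancy² {k} H = begin
      ∑[ f ∈ V ] (discrepancy H f) ²
        ≡⟨ ∑-cong V (λ f → ∑-square H (λ h → centred h f)) ⟩
      ∑[ f ∈ V ] ∑[ h ∈ H ] ∑[ h′ ∈ H ] centred h f * centred h′ f
        ≡⟨ ∑-swap V H _ ⟩
      ∑[ h ∈ H ] ∑[ f ∈ V ] ∑[ h′ ∈ H ] centred h f * centred h′ f
        ≡⟨ ∑-cong H (λ h → ∑-swap V H _) ⟩
      ∑[ h ∈ H ] ∑[ h′ ∈ H ] correlation h h′ ∎
      where
      open ≡-Reasoning
      V = vectors (suc k)

    discrepancy-cong : ∀ {k} (H : List (Hyperplane k)) → discrepancy H Preserves _≋_ ⟶ _≡_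
    discrepancy-cong H f≋f′ = ∑-cong H (λ h → cong (λ i → + q * i - 1ℤ) (𝟙-∈ₕ-cong h f≋f′))

    point-hyperplane-bound : ∀ {k} {H : List (Hyperplane k)} {L : List (Vec Carrier (suc k))} →
      UniqueSetoid.Unique (hyperplaneSetoid k) H → UniqueSetoid.Unique (≋-setoid (suc k)) L →
      (+ q * incidencesₕ H L - + length H * + length L) ²
        ≤ + (q ℕ.^ (suc k ℕ.+ 1)) * (+ length H * + length L)
    point-hyperplane-bound {k} {H} {L} H! L! = begin
      (+ q * incidencesₕ H L - + length H * + length L) ²
        ≡⟨ cong _² (incidences-discrepancy H L) ⟩
      (∑[ f ∈ L ] D f) ²
        ≤⟨ cauchy-schwarz L D ⟩
      + length L * (∑[ f ∈ L ] (D f) ²)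
        ≤⟨ ℤ.*-monoˡ-≤-nonNeg (+ length L)
             (∑-mono-⊆ (≋-setoid (suc k)) (0≤² ∘ D) (cong _² ∘ discrepancy-cong H) L!
                       (λ {f} _ → vectors-complete f)) ⟩
      + length L * (∑[ f ∈ vectors (suc k) ] (D f) ²)
        ≡⟨ cong (_*_ (+ length L)) (∑-discrepancy² H) ⟩
      + length L * (∑[ h ∈ H ] ∑[ h′ ∈ H ] correlation h h′)
        ≤⟨ ℤ.*-monoˡ-≤-nonNeg (+ length L)
             (∑∑-≤-diagonal (hyperplaneSetoid k) correlation-self correlation-distinct H!) ⟩
      + length L * (+ length H * bound)
        ≡⟨ rearrange (+ length L) (+ length H) bound ⟩
      bound * (+ length H * + length L) ∎
      where
      open ℤ.≤-Reasoning
      D = discrepancy H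
      bound = + (q ℕ.^ (suc k ℕ.+ 1))
      rearrange : ∀ l n b → l * (n * b) ≡ b * (n * l)
      rearrange = solve-∀

    monoValues : ∀ {m} (ms : List (Vec ℕ m)) → Vec Carrier m → Vec Carrier (length ms)
    monoValues []       x = []
    monoValues (e ∷ es) x = monoVal F e x ∷ monoValues es x

    -- Defs evaluates polynomials through a private helper; the _ below is solved to it by
    -- unification with the use in eval≡·.
    mutual
      evalAux≡· : ∀ {m} (x : Vec Carrier m) ms (f : Vec Carrier (length ms)) → _ ≡ f · monoValues ms x
      evalAux≡· x []       []       = refl
      evalAux≡· x (e ∷ es) (a ∷ as) = cong (_⊕_ (a ⊛ monoVal F e x)) (evalAux≡· x es as)

      eval≡· : ∀ {m r} (x : Vec Carrier m) (f : Poly F m r) →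
               eval F f x ≡ f · monoValues (monomials m r) x
      eval≡· {m} {r} x with monomials m r
      ... | ms = evalAux≡· x ms

    monoVal-replicate-0 : ∀ {m} (x : Vec Carrier m) → monoVal F (Vec.replicate m 0) x ≈ 1#
    monoVal-replicate-0 []      = ≈-refl
    monoVal-replicate-0 (a ∷ x) = ≈-trans (*-identityˡ _) (monoVal-replicate-0 x)

    -- The exponents 0 ∷ e recover the last m coordinates; 1 ∷ 0 ⋯ 0, present because the
    -- degree bound is at least 1, recovers the first.
    monomials-separate : ∀ m r {x x′ : Vec Carrier m} →
                         All (λ e → monoVal F e x ≈ monoVal F e x′) (monomials m (suc r)) → x ≋ x′
    monomials-separate zero    r {[]}     {[]}       _     = []
    monomials-separate (suc m) r {a ∷ x} {a′ ∷ x′} agree = a≈a′ ∷ x≋x′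
      where
      constant-in-a = List.map (0 ∷_) (monomials m (suc r))
      linear-in-a   = List.map (1 ∷_) (monomials m r)
      x≋x′ : x ≋ x′
      x≋x′ = monomials-separate m r
        (All.map (λ 1x≈1x′ → ≈-trans (≈-sym (*-identityˡ _)) (≈-trans 1x≈1x′ (*-identityˡ _)))
                 (Allₚ.map⁻ (Allₚ.++⁻ˡ constant-in-a agree)))
      a-monomial : monoVal F (1 ∷ Vec.replicate m 0) (a ∷ x) ≈
                   monoVal F (1 ∷ Vec.replicate m 0) (a′ ∷ x′)
      a-monomial with monomials-head m r | Allₚ.++⁻ˡ linear-in-a (Allₚ.++⁻ʳ constant-in-a agree)
      ... | es , eq | agree₁ = All.head (subst (λ ms → All _ (List.map (1 ∷_) ms)) eq agree₁)
      value : ∀ b y → monoVal F (1 ∷ Vec.replicate m 0) (b ∷ y) ≈ b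
      value b y = ≈-trans (*-cong (*-identityʳ b) (monoVal-replicate-0 y)) (*-identityʳ b)
      a≈a′ : a ≈ a′
      a≈a′ = ≈-trans (≈-sym (value a x)) (≈-trans a-monomial (value a′ x′))

    ≋-init-last : ∀ {n} {v w : Vec Carrier (suc n)} →
                  Vec.init v ≋ Vec.init w → Vec.last v ≈ Vec.last w → v ≋ w
    ≋-init-last {zero}  {_ ∷ []} {_ ∷ []} []             x≈y   = x≈y ∷ []
    ≋-init-last {suc n} {_ ∷ _}  {_ ∷ _}  (x≈y ∷ iv≋iw) lv≈lw = x≈y ∷ ≋-init-last iv≋iw lv≈lw

    monoValues-≋ : ∀ {m} (es : List (Vec ℕ m)) {x x′} →
                   monoValues es x ≋ monoValues es x′ → All (λ e → monoVal F e x ≈ monoVal F e x′) es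
    monoValues-≋ []       []       = []
    monoValues-≋ (e ∷ es) (p ∷ ps) = p ∷ monoValues-≋ es ps

    monomialIncidences : ∀ {m} (ms : List (Vec ℕ m)) →
                         List (Vec Carrier (suc m)) → List (Vec Carrier (length ms)) → ℤ
    monomialIncidences ms P L = ∑[ v ∈ P ] ∑[ f ∈ L ] 𝟙 ((f · monoValues ms (Vec.init v)) ≟ Vec.last v)

    graph : ∀ {m} (es : List (Vec ℕ m)) → Vec Carrier (suc m) → Hyperplane (length es)
    graph es v = monoValues es (Vec.init v) , Vec.last v

    ∈ₕ-graph⇔ : ∀ {m} (es : List (Vec ℕ m)) (f : Vec Carrier (suc (length es))) v →
                f ∈ₕ graph es v ⇔ f · monoValues (Vec.replicate m 0 ∷ es) (Vec.init v) ≈ Vec.last v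
    ∈ₕ-graph⇔ es (f₀ ∷ g) v = ≈ˡ-⇔ (+-cong (≈-sym f₀·1≈f₀) ≈-refl)
      where
      f₀·1≈f₀ = ≈-trans (*-cong ≈-refl (monoVal-replicate-0 (Vec.init v))) (*-identityʳ f₀)

    graph-injective : ∀ {m} (es : List (Vec ℕ m)) →
      (∀ {x x′} → All (λ e → monoVal F e x ≈ monoVal F e x′) (Vec.replicate m 0 ∷ es) → x ≋ x′) →
      ∀ {v w} → graph es v ≈ₕ graph es w → v ≋ w
    graph-injective es separate {v} {w} (values≋ , last≈) =
      ≋-init-last (separate (constant ∷ monoValues-≋ es values≋)) last≈
      where
      constant = ≈-trans (monoVal-replicate-0 (Vec.init v)) (≈-sym (monoVal-replicate-0 (Vec.init w)))

    graph-bound : ∀ {m} (es : List (Vec ℕ m)) →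
      (∀ {x x′} → All (λ e → monoVal F e x ≈ monoVal F e x′) (Vec.replicate m 0 ∷ es) → x ≋ x′) →
      ∀ {P} → UniqueSetoid.Unique (≋-setoid (suc m)) P →
      ∀ {L} → UniqueSetoid.Unique (≋-setoid (suc (length es))) L →
      (+ q * monomialIncidences (Vec.replicate m 0 ∷ es) P L - + length P * + length L) ²
        ≤ + (q ℕ.^ (suc (length es) ℕ.+ 1)) * (+ length P * + length L)
    graph-bound {m} es separate {P} P! {L} L! = begin
      (+ q * monomialIncidences (Vec.replicate m 0 ∷ es) P L - + length P * + length L) ²
        ≡⟨ cong₂ (λ i n → (+ q * i - + n * + length L) ²)
                 incidences-graph (sym (Listₚ.length-map (graph es) P)) ⟩
      (+ q * incidencesₕ H L - + length H * + length L) ²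
        ≤⟨ point-hyperplane-bound
             (Uniqueₚ.map⁺ (≋-setoid (suc m)) (hyperplaneSetoid (length es))
                           (graph-injective es separate) P!)
             L! ⟩
      bound * (+ length H * + length L)
        ≡⟨ cong (λ n → bound * (+ n * + length L)) (Listₚ.length-map (graph es) P) ⟩
      bound * (+ length P * + length L) ∎
      where
      open ℤ.≤-Reasoning
      H = List.map (graph es) P
      bound = + (q ℕ.^ (suc (length es) ℕ.+ 1))
      incidences-graph : monomialIncidences (Vec.replicate m 0 ∷ es) P L ≡ incidencesₕ H L
      incidences-graph = sym (trans (∑-map (graph es) P _) (∑-cong P (λ v → ∑-cong L (λ f →
        𝟙-⇔ (∈ₕ-graph⇔ es f v) (f ∈ₕ? graph es v)
            ((f · monoValues (Vec.replicate m 0 ∷ es) (Vec.init v)) ≟ Vec.last v)))))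

    polynomial-bound : ∀ {m} r {P : List (Vec Carrier (suc m))} → UniquePoints F P →
      {L : List (Vec Carrier (length (monomials m (suc r))))} →
      UniqueSetoid.Unique (≋-setoid (length (monomials m (suc r)))) L →
      (+ q * monomialIncidences (monomials m (suc r)) P L - + length P * + length L) ²
        ≤ + (q ℕ.^ (length (monomials m (suc r)) ℕ.+ 1)) * (+ length P * + length L)
    polynomial-bound {m} r with monomials m (suc r) | monomials-head m (suc r) | monomials-separate m r
    ... | _ | es , refl | separate = graph-bound es separate

    +incidences≡ : ∀ {m r} (P : List (Vec Carrier (suc m))) (L : List (Poly F m r)) →
      + incidences F {m} {r} P L ≡ monomialIncidences (monomials m r) P L
    +incidences≡ {m} {r} P L =
      trans (+sum≡∑ P _) (∑-cong P (λ v → trans (+sum≡∑ L _) (∑-cong L (λ f →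
        trans (+incident≡ v f) (cong (λ z → 𝟙 (z ≟ Vec.last v)) (eval≡· {m} {r} (Vec.init v) f))))))
      where
      +incident≡ : ∀ v (f : Poly F m r) →
                   + incident F {m} {r} v f ≡ 𝟙 (eval F {m} {r} f (Vec.init v) ≟ Vec.last v)
      +incident≡ v f with eval F {m} {r} f (Vec.init v) ≟ Vec.last v
      ... | yes _ = refl
      ... | no  _ = refl

    polynomial-incidence-bound : ∀ m r {P : List (Vec Carrier (suc m))} → UniquePoints F P →
      {L : List (Poly F m (suc r))} → UniquePolys F {m} {suc r} L →
      (+ (q ℕ.* incidences F {m} {suc r} P L) - + (length P ℕ.* length L)) ²
        ≤ + (q ℕ.^ ((m ℕ.+ suc r) C suc r ℕ.+ 1) ℕ.* (length P ℕ.* length L))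
    polynomial-incidence-bound m r {P} P! {L} L! = begin
      (+ (q ℕ.* incidences F {m} {suc r} P L) - + (length P ℕ.* length L)) ²
        ≡⟨ cong₂ (λ i j → (i - j) ²) (ℤ.pos-* q _) (ℤ.pos-* (length P) _) ⟩
      (+ q * + incidences F {m} {suc r} P L - + length P * + length L) ²
        ≡⟨ cong (λ i → (+ q * i - + length P * + length L) ²) (+incidences≡ P L) ⟩
      (+ q * monomialIncidences (monomials m (suc r)) P L - + length P * + length L) ²
        ≤⟨ polynomial-bound r P! L! ⟩
      + (q ℕ.^ (length (monomials m (suc r)) ℕ.+ 1)) * (+ length P * + length L)
        ≡⟨ cong₂ (λ n k → + (q ℕ.^ (n ℕ.+ 1)) * k)
                 (length-monomials m (suc r)) (sym (ℤ.pos-* (length P) _)) ⟩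
      + (q ℕ.^ ((m ℕ.+ suc r) C suc r ℕ.+ 1)) * + (length P ℕ.* length L)
        ≡⟨ ℤ.pos-* (q ℕ.^ ((m ℕ.+ suc r) C suc r ℕ.+ 1)) _ ⟨
      + (q ℕ.^ ((m ℕ.+ suc r) C suc r ℕ.+ 1) ℕ.* (length P ℕ.* length L)) ∎
      where open ℤ.≤-Reasoning


open import Defs
open import Level using (Level)
open import Data.Nat using (ℕ; suc; _*_; _^_; _≤_; _+_; ∣_-_∣)
open import Data.Nat.Combinatorics using (_C_)
open import Data.List using (List; length)
open import Data.Vec using (Vec)
open IncidenceBound using (∣m-n∣²≤-from-ℤ; polynomial-incidence-bound)

proposition1p1 : ∀ {c ℓ : Level} (F : FiniteField c ℓ) (m r : ℕ) → 1 ≤ m → 1 ≤ r →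
    (P : List (Vec (FiniteField.Carrier F) (suc m))) → UniquePoints F P →
    (L : List (Poly F m r)) → UniquePolys F {m} {r} L →
    ∣ FiniteField.order F * incidences F P L - length P * length L ∣ ^ 2
      ≤ FiniteField.order F ^ ((m + r) C r + 1) * (length P * length L)
proposition1p1 F m (suc r) _ _ P P! L L! =
  ∣m-n∣²≤-from-ℤ (FiniteField.order F * incidences F P L) (length P * length L) _
    (polynomial-incidence-bound F m r P! L!)
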